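{- Let $q\ge5$ and $\mu\in\mathbb{F}_q\setminus\{0,1\}$, and let $\ell_\mu$ be the line through $\mathrm{P}(0,\mu,0,1)$ and $\mathrm{P}(1,0,1,0)$. Then $\ell_\mu$ is an $E_n\Gamma$-line in each of the following cases: (i) $q$ is even; (ii) $q\equiv0\pmod3$; (iii) $q\not\equiv0\pmod3$, $q$ is odd, and $\mu\neq1/9$.
   Context: $\mathrm{P}(x_0,x_1,x_2,x_3)$ denotes a point of $\mathrm{PG}(3,q)$ in homogeneous coordinates. The twisted cubic is $\mathcal{C}=\{P(t): t\in\mathbb{F}_q\cup\{\infty\}\}$, $P(t)=\mathrm{P}(t^3,t^2,t,1)$ for $t\in\mathbb{F}_q$, $P(\infty)=\mathrm{P}(1,0,0,0)$; the same formula defines $P(t)$ for $t\in\mathbb{F}_{q^2}$. The osculating plane at $P(t)$ is $\pi(t): x_0-3tx_1+3t^2x_2-t^3x_3=0$ for $t$ in $\mathbb{F}_q$ (or $\mathbb{F}_{q^2}$), and $\pi(\infty): x_3=0$. An imaginary chord is the line joining $P(t)$ and $P(t^q)$ for some $t\in\mathbb{F}_{q^2}\setminus\mathbb{F}_q$; an imaginary axis is the line $\pi(t)\cap\pi(t^q)$ for some $t\in\mathbb{F}_{q^2}\setminus\mathbb{F}_q$. An $E_n\Gamma$-line is a line of $\mathrm{PG}(3,q)$ containing no point of $\mathcal{C}$, not contained in any osculating plane $\pi(t)$, $t\in\mathbb{F}_q\cup\{\infty\}$, and which is neither an imaginary chord nor an imaginary axis. -}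

module Defs where

open import Level using (0ℓ)
open import Data.Nat using (ℕ)
import Data.Nat as ℕ
open import Data.Fin using (Fin)
import Data.Fin as F
open import Data.Product using (Σ; ∃; _×_; _,_)
open import Relation.Nullary using (¬_)
open import Relation.Binary.Definitions using (Decidable)
open import Relation.Binary.PropositionalEquality using (_≡_)
open import Algebra.Bundles using (CommutativeRing)
open import Algebra.Morphism.Structures using (module RingMorphisms)

record IsFiniteField (F : CommutativeRing 0ℓ 0ℓ) (n : ℕ) : Set where
  open CommutativeRing F
  field
    1≉0     : ¬ (1# ≈ 0#)
    inverse : ∀ x → ¬ (x ≈ 0#) → ∃ λ y → x * y ≈ 1#
    _≟_     : Decidable _≈_
    enum    : Fin n → Carrier
    enum-injective  : ∀ i j → enum i ≈ enum j → i ≡ j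
    enum-surjective : ∀ x → ∃ λ i → enum i ≈ x

IsRingHom : (F K : CommutativeRing 0ℓ 0ℓ) →
            (CommutativeRing.Carrier F → CommutativeRing.Carrier K) → Set
IsRingHom F K ι =
  RingMorphisms.IsRingHomomorphism (CommutativeRing.rawRing F) (CommutativeRing.rawRing K) ι

module Geometry (R : CommutativeRing 0ℓ 0ℓ) where
  open CommutativeRing R hiding (zero)

  Vec4 : Set
  Vec4 = Fin 4 → Carrier

  mk : Carrier → Carrier → Carrier → Carrier → Vec4
  mk a b c d F.zero = a
  mk a b c d (F.suc F.zero) = b
  mk a b c d (F.suc (F.suc F.zero)) = c
  mk a b c d (F.suc (F.suc (F.suc F.zero))) = d

  x₀ x₁ x₂ x₃ : Vec4 → Carrier
  x₀ X = X F.zero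
  x₁ X = X (F.suc F.zero)
  x₂ X = X (F.suc (F.suc F.zero))
  x₃ X = X (F.suc (F.suc (F.suc F.zero)))

  pow : Carrier → ℕ → Carrier
  pow t ℕ.zero = 1#
  pow t (ℕ.suc n) = t * pow t n

  two three nine : Carrier
  two = 1# + 1#
  three = 1# + 1# + 1#
  nine = three * three

  P : Carrier → Vec4
  P t = mk (t * t * t) (t * t) t 1#

  P∞ : Vec4
  P∞ = mk 1# 0# 0# 0#

  OnLine : Vec4 → Vec4 → Vec4 → Set
  OnLine A B X = ∃ λ a → ∃ λ b → ∀ i → X i ≈ a * A i + b * B i

  InOsc : Carrier → Vec4 → Set
  InOsc t X =
    x₀ X - three * t * x₁ X + three * (t * t) * x₂ X - t * t * t * x₃ X ≈ 0#

  InOsc∞ : Vec4 → Set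
  InOsc∞ X = x₃ X ≈ 0#

-- E_nΓ-lines.  F = F_q, K = F_{q²}, ι : F → K the embedding.
-- The line ℓ of PG(3,q) is given by two independent vectors A, B over F.

module EnΓ (q : ℕ) (Fq K : CommutativeRing 0ℓ 0ℓ)
           (ι : CommutativeRing.Carrier Fq → CommutativeRing.Carrier K) where
  module GF = Geometry Fq
  module GK = Geometry K
  open CommutativeRing K using () renaming (Carrier to KC; _≈_ to _≈K_)

  ιv : GF.Vec4 → GK.Vec4
  ιv X i = ι (X i)

  NotInBase : KC → Set
  NotInBase t = ¬ (∃ λ a → ι a ≈K t)

  -- ℓ = AB is the imaginary chord P(t)P(t^q): the extension of ℓ to
  -- PG(3,q²) contains P(t) and P(t^q) (which are distinct points).
  ImaginaryChord : GF.Vec4 → GF.Vec4 → Set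
  ImaginaryChord A B = ∃ λ t → NotInBase t ×
    (GK.OnLine (ιv A) (ιv B) (GK.P t) × GK.OnLine (ιv A) (ιv B) (GK.P (GK.pow t q)))

  -- ℓ = AB is the imaginary axis π(t) ∩ π(t^q): ℓ lies in both
  -- (distinct) planes π(t) and π(t^q).
  ImaginaryAxis : GF.Vec4 → GF.Vec4 → Set
  ImaginaryAxis A B = ∃ λ t → NotInBase t ×
    ((GK.InOsc t (ιv A) × GK.InOsc t (ιv B)) ×
     (GK.InOsc (GK.pow t q) (ιv A) × GK.InOsc (GK.pow t q) (ιv B)))

  record IsEnΓLine (A B : GF.Vec4) : Set where
    field
      noCubicPoint   : ∀ t → ¬ GF.OnLine A B (GF.P t)
      noCubicPoint∞  : ¬ GF.OnLine A B GF.P∞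
      notInOsc       : ∀ t → ¬ (GF.InOsc t A × GF.InOsc t B)
      notInOsc∞      : ¬ (GF.InOsc∞ A × GF.InOsc∞ B)
      notImagChord   : ¬ ImaginaryChord A B
      notImagAxis    : ¬ ImaginaryAxis A B

module LineMu (R : CommutativeRing 0ℓ 0ℓ) where
  open CommutativeRing R hiding (zero)
  open Geometry R

  Aμ : Carrier → Vec4
  Aμ μ = mk 0# μ 0# 1#

  B₀ : Vec4
  B₀ = mk 1# 0# 1# 0#

-- If P(t) lay on ℓ_μ, then t³ = t and t² = μ, so t ∈ {0, ±1} and μ ∈ {0, 1}; over F_{q²} the same
-- equations give t ∈ {0, ±1} ⊆ F_q, so ℓ_μ is no imaginary chord.  If ℓ_μ lay in π(t), then
-- 3t² = −1 and t³ = −3tμ, whence 9μ = 1, over F_q or, through the injective embedding, over F_{q²}.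
-- But 9μ = μ ≠ 1 in characteristic 2, 9μ = 0 in characteristic 3, and 9μ ≠ 1 is assumed otherwise.
-- The characteristic is read off from q by counting fixed points: if 2 ≠ 0, negation is an
-- involution of F_q fixing only 0, so q is odd; if 3 ≠ 0, the map (a, b) ↦ (b, −a − b) has order 3
-- on F_q² and fixes only (0, 0), so q² ≡ 1 (mod 3).

{-# OPTIONS --safe #-}
module Submission where

open import Level using (0ℓ)
open import Data.Nat as ℕ using (ℕ)
open import Data.Nat.Properties as ℕ using ()
open import Data.Nat.Divisibility using (_∣_; ∣1⇒≡1; ∣m+n∣m⇒∣n; n∣m*n; ∣m⇒∣m*n; m%n≡0⇒n∣m)
open import Data.Nat.Induction using (<-wellFounded)
open import Induction.WellFounded using (Acc; acc)
open import Data.Fin as Fin using (Fin; toℕ; fromℕ<; remQuot; combine)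
open import Data.Fin.Patterns using (0F; 1F; 2F; 3F)
open import Data.Fin.Properties using (toℕ-injective; toℕ<n; toℕ-fromℕ<; remQuot-combine; combine-remQuot)
open import Data.List using (List; []; _∷_; _++_; length; map; tabulate; filter; allFin)
open import Data.List.Properties using (length-++; length-map; length-tabulate)
open import Data.List.Membership.Propositional using (_∈_)
open import Data.List.Membership.Propositional.Properties
  using (∈-++⁺ˡ; ∈-++⁺ʳ; ∈-++⁻; ∈-filter⁺; ∈-filter⁻; ∈-tabulate⁺; ∈-tabulate⁻; ∈-map⁺; ∈-allFin)
open import Data.List.Membership.Propositional.Properties.WithK using (unique∧set⇒bag)
import Data.List.Membership.DecPropositional as DecMembership
open import Data.List.Relation.Unary.Any using (here)
import Data.List.Relation.Unary.All as All
import Data.List.Relation.Unary.AllPairs as AllPairs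
open import Data.List.Relation.Unary.Unique.Propositional using (Unique)
open import Data.List.Relation.Unary.Unique.Propositional.Properties
  using (++⁺; filter⁺; tabulate⁺; map⁺; allFin⁺)
open import Data.List.Relation.Binary.BagAndSetEquality using (∼bag⇒↭)
open import Data.List.Relation.Binary.Permutation.Propositional.Properties using (↭-length)
open import Data.Product using (∃; ∃-syntax; _×_; _,_; proj₁; proj₂; uncurry)
open import Data.Product.Properties using (≡-dec)
open import Data.Sum using (_⊎_; inj₁; inj₂; [_,_]; [_,_]′)
open import Data.Empty using (⊥; ⊥-elim)
open import Function.Bundles using (mk⇔)
open import Relation.Nullary using (¬_; yes; no)
open import Relation.Binary.Definitions using (DecidableEquality; tri<; tri≈; tri>)
open import Relation.Binary.PropositionalEquality as ≡ using (_≡_; _≢_; cong; cong₂)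
open import Algebra.Bundles using (CommutativeRing)
open import Algebra.Morphism.Structures using (module RingMorphisms)
import Algebra.Properties.AbelianGroup as AbelianGroupProperties
import Algebra.Solver.Ring.NaturalCoefficients.Default as NaturalCoefficients
open import Defs

module _ {A : Set} (_≟_ : DecidableEquality A) where
  open import Data.Nat using (zero; suc; pred; _+_; _*_; _∸_; _<_; NonZero; >-nonZero⁻¹)
  open import Data.Nat.Properties
    using (<-cmp; ≤-refl; ≤-trans; <⇒≤; +-comm; m≤m+n; m<n+m; +-monoʳ-<; m∸n+n≡m; m<n⇒0<n∸m;
           suc-pred; m≤pred[n]⇒suc[m]≤n)
  open import Data.Nat.Divisibility using (divides; _∣0; ∣-refl; ∣m∣n⇒∣m+n)
  open ≡ using (refl; sym; trans; subst; cong-app; module ≡-Reasoning)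
  open DecMembership _≟_ using (_∈?_; _∉?_)
  open import Function.Endo.Propositional A using (_^_; ^-homo)

  length-++-filter-∉ : ∀ {O L : List A} → Unique O → Unique L → (∀ {x} → x ∈ O → x ∈ L) →
                       length L ≡ length O + length (filter (_∉? O) L)
  length-++-filter-∉ {O} {L} uO uL O⊆L = trans
      (↭-length (∼bag⇒↭ (unique∧set⇒bag uL (++⁺ uO (filter⁺ (_∉? O) uL) disjoint) (mk⇔ to from))))
      (length-++ O)
    where
    disjoint : ∀ {x} → ¬ (x ∈ O × x ∈ filter (_∉? O) L)
    disjoint (x∈O , x∈L') = proj₂ (∈-filter⁻ (_∉? O) {xs = L} x∈L') x∈O
    to : ∀ {x} → x ∈ L → x ∈ O ++ filter (_∉? O) L
    to {x} x∈L with x ∈? O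
    ... | yes x∈O = ∈-++⁺ˡ x∈O
    ... | no  x∉O = ∈-++⁺ʳ O (∈-filter⁺ (_∉? O) {xs = L} x∈L x∉O)
    from : ∀ {x} → x ∈ O ++ filter (_∉? O) L → x ∈ L
    from x∈ = [ O⊆L , (λ m → proj₁ (∈-filter⁻ (_∉? O) {xs = L} m)) ] (∈-++⁻ O x∈)

  module OrbitCounting (σ : A → A) (k : ℕ) .{{_ : NonZero k}}
                       (σ^k≡id : ∀ x → (σ ^ k) x ≡ x)
                       (σ^i-moves : ∀ x → σ x ≢ x → ∀ {i} → 0 < i → i < k → (σ ^ i) x ≢ x)
                       where

    ^-+ : ∀ m n x → (σ ^ (m + n)) x ≡ (σ ^ m) ((σ ^ n) x)
    ^-+ m n = cong-app (^-homo σ m n)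

    σ⁻¹ : A → A
    σ⁻¹ = σ ^ pred k

    σ⁻¹∘σ : ∀ x → σ⁻¹ (σ x) ≡ x
    σ⁻¹∘σ x = begin
      (σ ^ pred k) ((σ ^ 1) x) ≡⟨ ^-+ (pred k) 1 x ⟨
      (σ ^ (pred k + 1)) x     ≡⟨ cong (λ n → (σ ^ n) x) (trans (+-comm (pred k) 1) (suc-pred k)) ⟩
      (σ ^ k) x                ≡⟨ σ^k≡id x ⟩
      x                        ∎
      where open ≡-Reasoning

    σ-injective : ∀ {x y} → σ x ≡ σ y → x ≡ y
    σ-injective {x} {y} e = trans (sym (σ⁻¹∘σ x)) (trans (cong σ⁻¹ e) (σ⁻¹∘σ y))

    orbit : A → List A
    orbit x = tabulate {n = k} (λ i → (σ ^ toℕ i) x)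

    ∈-orbit⁺ : ∀ {i} x → i < k → (σ ^ i) x ∈ orbit x
    ∈-orbit⁺ x i<k = subst (λ n → (σ ^ n) x ∈ orbit x) (toℕ-fromℕ< i<k) (∈-tabulate⁺ (fromℕ< i<k))

    ∈-orbit⁻ : ∀ {x y} → y ∈ orbit x → ∃[ i ] i < k × y ≡ (σ ^ i) x
    ∈-orbit⁻ y∈ with ∈-tabulate⁻ y∈
    ... | i , y≡ = toℕ i , toℕ<n i , y≡

    σ⁻¹-orbit : ∀ {x y} → y ∈ orbit x → σ⁻¹ y ∈ orbit x
    σ⁻¹-orbit {x} y∈ with ∈-orbit⁻ y∈
    ... | zero  , _     , refl = ∈-orbit⁺ x (m≤pred[n]⇒suc[m]≤n ≤-refl)
    ... | suc i , i+1<k , refl = subst (_∈ orbit x) (sym (σ⁻¹∘σ ((σ ^ i) x))) (∈-orbit⁺ x (<⇒≤ i+1<k))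

    σ-orbit⁻ : ∀ {x y} → σ y ∈ orbit x → y ∈ orbit x
    σ-orbit⁻ {x} {y} σy∈ = subst (_∈ orbit x) (σ⁻¹∘σ y) (σ⁻¹-orbit σy∈)

    ^-injective-below : ∀ {x a b} → σ x ≢ x → a < b → b < k → (σ ^ a) x ≢ (σ ^ b) x
    ^-injective-below {x} {a} {b} σx≢x a<b b<k e = σ^i-moves x σx≢x 0<c c<k (begin
        (σ ^ c) x                   ≡⟨ ^-+ (k ∸ b) a x ⟩
        (σ ^ (k ∸ b)) ((σ ^ a) x)   ≡⟨ cong (σ ^ (k ∸ b)) e ⟩
        (σ ^ (k ∸ b)) ((σ ^ b) x)   ≡⟨ ^-+ (k ∸ b) b x ⟨
        (σ ^ (k ∸ b + b)) x         ≡⟨ cong (λ n → (σ ^ n) x) (m∸n+n≡m (<⇒≤ b<k)) ⟩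
        (σ ^ k) x                   ≡⟨ σ^k≡id x ⟩
        x                           ∎)
      where
      open ≡-Reasoning
      c = k ∸ b + a
      0<c : 0 < c
      0<c = ≤-trans (m<n⇒0<n∸m b<k) (m≤m+n (k ∸ b) a)
      c<k : c < k
      c<k = subst (c <_) (m∸n+n≡m (<⇒≤ b<k)) (+-monoʳ-< (k ∸ b) a<b)

    orbit-unique : ∀ x → σ x ≢ x → Unique (orbit x)
    orbit-unique x σx≢x = tabulate⁺ injective
      where
      injective : ∀ {i j : Fin k} → (σ ^ toℕ i) x ≡ (σ ^ toℕ j) x → i ≡ j
      injective {i} {j} e with <-cmp (toℕ i) (toℕ j)
      ... | tri< i<j _ _ = ⊥-elim (^-injective-below σx≢x i<j (toℕ<n j) e)
      ... | tri≈ _ i≡j _ = toℕ-injective i≡j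
      ... | tri> _ _ j<i = ⊥-elim (^-injective-below σx≢x j<i (toℕ<n i) (sym e))

    ^-closed : ∀ {L} → (∀ {y} → y ∈ L → σ y ∈ L) → ∀ i {x} → x ∈ L → (σ ^ i) x ∈ L
    ^-closed closed zero    x∈L = x∈L
    ^-closed closed (suc i) x∈L = closed (^-closed closed i x∈L)

    k∣length : ∀ {L} → Unique L → (∀ {x} → x ∈ L → σ x ∈ L) → (∀ {x} → x ∈ L → σ x ≢ x) →
               k ∣ length L
    k∣length {L} = go L (<-wellFounded (length L))
      where
      go : ∀ L → Acc _<_ (length L) → Unique L → (∀ {x} → x ∈ L → σ x ∈ L) →
           (∀ {x} → x ∈ L → σ x ≢ x) → k ∣ length L
      go []          _         _  _      _     = k ∣0
      go L@(x ∷ _) (acc rec) uL closed nofix =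
          subst (k ∣_) (sym length≡) (∣m∣n⇒∣m+n ∣-refl (go L' (rec shorter) uL' closed' nofix'))
        where
        O  = orbit x
        L' = filter (_∉? O) L
        length≡ : length L ≡ k + length L'
        length≡ = trans (length-++-filter-∉ (orbit-unique x (nofix (here refl))) uL O⊆L)
                        (cong (_+ length L') (length-tabulate _))
          where
          O⊆L : ∀ {y} → y ∈ O → y ∈ L
          O⊆L y∈O with ∈-orbit⁻ y∈O
          ... | i , _ , refl = ^-closed closed i (here refl)
        shorter : length L' < length L
        shorter = subst (length L' <_) (sym length≡) (m<n+m (length L') (>-nonZero⁻¹ k))
        uL' : Unique L'
        uL' = filter⁺ (_∉? O) uL
        closed' : ∀ {y} → y ∈ L' → σ y ∈ L'
        closed' y∈L' with ∈-filter⁻ (_∉? O) {xs = L} y∈L'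
        ... | y∈L , y∉O = ∈-filter⁺ (_∉? O) {xs = L} (closed y∈L) (λ σy∈O → y∉O (σ-orbit⁻ σy∈O))
        nofix' : ∀ {y} → y ∈ L' → σ y ≢ y
        nofix' y∈L' = nofix (proj₁ (∈-filter⁻ (_∉? O) {xs = L} y∈L'))

    length≡1+m*k : ∀ {z L} → σ z ≡ z → (∀ {y} → σ y ≡ y → y ≡ z) → Unique L → (∀ y → y ∈ L) →
                   ∃[ m ] length L ≡ 1 + m * k
    length≡1+m*k {z} {L} σz≡z fixed≡z uL complete with k∣length uL' closed' nofix'
      where
      L' = filter (_∉? (z ∷ [])) L
      uL' : Unique L'
      uL' = filter⁺ (_∉? (z ∷ [])) uL
      closed' : ∀ {y} → y ∈ L' → σ y ∈ L'
      closed' y∈L' with ∈-filter⁻ (_∉? (z ∷ [])) {xs = L} y∈L'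
      ... | _ , y∉z = ∈-filter⁺ (_∉? (z ∷ [])) {xs = L} (complete _)
                        λ { (here σy≡z) → y∉z (here (σ-injective (trans σy≡z (sym σz≡z)))) }
      nofix' : ∀ {y} → y ∈ L' → σ y ≢ y
      nofix' y∈L' σy≡y = proj₂ (∈-filter⁻ (_∉? (z ∷ [])) {xs = L} y∈L') (here (fixed≡z σy≡y))
    ... | divides m length≡m*k =
      m , trans (length-++-filter-∉ (All.[] AllPairs.∷ AllPairs.[]) uL (λ { (here refl) → complete z }))
                (cong suc length≡m*k)

∣1+m*n⇒≡1 : ∀ m {n} → n ∣ 1 ℕ.+ m ℕ.* n → n ≡ 1
∣1+m*n⇒≡1 m {n} n∣1+m*n =
  ∣1⇒≡1 (∣m+n∣m⇒∣n (≡.subst (n ∣_) (ℕ.+-comm 1 (m ℕ.* n)) n∣1+m*n) (n∣m*n m))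

module FiniteField {F : CommutativeRing 0ℓ 0ℓ} {q : ℕ} (isFiniteField : IsFiniteField F q) where
  open CommutativeRing F
  open IsFiniteField isFiniteField
  open Geometry F using (two; three; nine)
  open AbelianGroupProperties +-abelianGroup using (inverseʳ-unique; ⁻¹-involutive; ε⁻¹≈ε)
  open NaturalCoefficients commutativeSemiring using (solve; _:=_; _:+_; _:*_; con)
  open import Relation.Binary.Reasoning.Setoid setoid

  *-cancelˡ : ∀ {x y z} → ¬ x ≈ 0# → x * y ≈ x * z → y ≈ z
  *-cancelˡ {x} {y} {z} x≉0 xy≈xz with inverse x x≉0
  ... | x⁻¹ , xx⁻¹≈1 = begin
    y               ≈⟨ *-identityˡ y ⟨
    1# * y          ≈⟨ *-congʳ xx⁻¹≈1 ⟨
    x * x⁻¹ * y     ≈⟨ solve 3 (λ x u y → x :* u :* y := u :* (x :* y)) refl x x⁻¹ y ⟩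
    x⁻¹ * (x * y)   ≈⟨ *-congˡ xy≈xz ⟩
    x⁻¹ * (x * z)   ≈⟨ solve 3 (λ x u z → u :* (x :* z) := x :* u :* z) refl x x⁻¹ z ⟩
    x * x⁻¹ * z     ≈⟨ *-congʳ xx⁻¹≈1 ⟩
    1# * z          ≈⟨ *-identityˡ z ⟩
    z               ∎

  x*x*x≈x⇒x≈0⊎x*x≈1 : ∀ {x} → x * x * x ≈ x → x ≈ 0# ⊎ x * x ≈ 1#
  x*x*x≈x⇒x≈0⊎x*x≈1 {x} x³≈x with x ≟ 0#
  ... | yes x≈0 = inj₁ x≈0
  ... | no  x≉0 = inj₂ (*-cancelˡ x≉0 (begin
    x * (x * x)  ≈⟨ *-assoc x x x ⟨
    x * x * x    ≈⟨ x³≈x ⟩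
    x            ≈⟨ *-identityʳ x ⟨
    x * 1#       ∎))

  x*x≈1⇒x≈1⊎x≈-1 : ∀ {x} → x * x ≈ 1# → x ≈ 1# ⊎ x ≈ - 1#
  x*x≈1⇒x≈1⊎x≈-1 {x} x²≈1 with (x + 1#) ≟ 0#
  ... | yes x+1≈0 = inj₂ (inverseʳ-unique 1# x (trans (+-comm 1# x) x+1≈0))
  ... | no  x+1≉0 = inj₁ (*-cancelˡ x+1≉0 (begin
    (x + 1#) * x   ≈⟨ solve 1 (λ x → (x :+ con 1) :* x := x :* x :+ x) refl x ⟩
    x * x + x      ≈⟨ +-congʳ x²≈1 ⟩
    1# + x         ≈⟨ solve 1 (λ x → con 1 :+ x := (x :+ con 1) :* con 1) refl x ⟩
    (x + 1#) * 1#  ∎))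

  index : Carrier → Fin q
  index x = proj₁ (enum-surjective x)

  enum-index : ∀ x → enum (index x) ≈ x
  enum-index x = proj₂ (enum-surjective x)

  index-unique : ∀ {x i} → enum i ≈ x → index x ≡ i
  index-unique {x} e = enum-injective _ _ (trans (enum-index x) (sym e))

  index-cong : ∀ {x y} → x ≈ y → index x ≡ index y
  index-cong {x} x≈y = ≡.sym (index-unique (trans (enum-index x) x≈y))

  o : Fin q
  o = index 0#

  enum-o : enum o ≈ 0#
  enum-o = enum-index 0#

  pairs : List (Fin q × Fin q)
  pairs = map (remQuot {q} q) (allFin (q ℕ.* q))

  pairs-unique : Unique pairs
  pairs-unique = map⁺ remQuot-injective (allFin⁺ (q ℕ.* q))
    where
    remQuot-injective : ∀ {i j} → remQuot {q} q i ≡ remQuot {q} q j → i ≡ j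
    remQuot-injective {i} {j} e =
      ≡.trans (≡.sym (combine-remQuot {q} q i)) (≡.trans (cong (uncurry combine) e) (combine-remQuot {q} q j))

  ∈-pairs : ∀ p → p ∈ pairs
  ∈-pairs (a , b) =
    ≡.subst (_∈ pairs) (remQuot-combine {q} {q} a b) (∈-map⁺ (remQuot {q} q) (∈-allFin (combine a b)))

  length-pairs : length pairs ≡ q ℕ.* q
  length-pairs =
    ≡.trans (length-map (remQuot {q} q) (allFin (q ℕ.* q))) (length-tabulate {n = q ℕ.* q} (λ i → i))

  negate : Fin q → Fin q
  negate i = index (- enum i)

  enum-negate : ∀ i → enum (negate i) ≈ - enum i
  enum-negate i = enum-index (- enum i)

  negate-involutive : ∀ i → negate (negate i) ≡ i
  negate-involutive i = index-unique (trans (sym (⁻¹-involutive (enum i))) (-‿cong (sym (enum-negate i))))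

  negate-o : negate o ≡ o
  negate-o = index-cong (trans (-‿cong enum-o) ε⁻¹≈ε)

  module _ where
    open import Function.Endo.Propositional (Fin q) using (_^_)

    negate^i-moves : ∀ i → negate i ≢ i → ∀ {n} → 0 ℕ.< n → n ℕ.< 2 → (negate ^ n) i ≢ i
    negate^i-moves i moves {1} _ _ = moves
    negate^i-moves i moves {ℕ.suc (ℕ.suc _)} _ (ℕ.s≤s (ℕ.s≤s ()))

  third : Fin q → Fin q → Fin q
  third a b = index (- (enum a + enum b))

  sum-third : ∀ a b → enum a + enum b + enum (third a b) ≈ 0#
  sum-third a b = trans (+-congˡ (enum-index _)) (-‿inverseʳ _)

  third-unique : ∀ {a b c} → enum a + enum b + enum c ≈ 0# → third a b ≡ c
  third-unique sum≈0 = index-unique (inverseʳ-unique _ _ sum≈0)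

  third-rotate : ∀ a b → third b (third a b) ≡ a
  third-rotate a b = third-unique (trans (solve 3 (λ x y z → y :+ z :+ x := x :+ y :+ z) refl _ _ _) (sum-third a b))

  rotate : Fin q × Fin q → Fin q × Fin q
  rotate (a , b) = b , third a b

  rotate³≡id : ∀ p → rotate (rotate (rotate p)) ≡ p
  rotate³≡id (a , b) = cong₂ _,_ (third-rotate a b) (third-rotate b (third a b))

  rotate-o : rotate (o , o) ≡ (o , o)
  rotate-o = cong (o ,_) (third-unique (begin
    enum o + enum o + enum o  ≈⟨ +-cong (+-cong enum-o enum-o) enum-o ⟩
    0# + 0# + 0#              ≈⟨ solve 0 (con 0 :+ con 0 :+ con 0 := con 0) refl ⟩
    0#                        ∎))

  module _ where
    open import Function.Endo.Propositional (Fin q × Fin q) using (_^_)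

    rotate^i-moves : ∀ p → rotate p ≢ p → ∀ {n} → 0 ℕ.< n → n ℕ.< 3 → (rotate ^ n) p ≢ p
    rotate^i-moves p moves {1} _ _ = moves
    rotate^i-moves p moves {2} _ _ rotate²p≡p =
      moves (≡.trans (≡.sym (cong rotate rotate²p≡p)) (rotate³≡id p))
    rotate^i-moves p moves {ℕ.suc (ℕ.suc (ℕ.suc _))} _ (ℕ.s≤s (ℕ.s≤s (ℕ.s≤s ())))

  2∣q⇒two≈0 : 2 ∣ q → two ≈ 0#
  2∣q⇒two≈0 2∣q with two ≟ 0#
  ... | yes two≈0 = two≈0
  ... | no  two≉0 = ⊥-elim (2≢1 (∣1+m*n⇒≡1 m (≡.subst (2 ∣_) q≡1+m*2 2∣q)))
    where
    2≢1 : 2 ≢ 1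
    2≢1 ()
    fixed⇒o : ∀ {i} → negate i ≡ i → i ≡ o
    fixed⇒o {i} negate-i≡i = ≡.sym (index-unique (*-cancelˡ two≉0 (begin
      two * enum i       ≈⟨ solve 1 (λ x → (con 1 :+ con 1) :* x := x :+ x) refl (enum i) ⟩
      enum i + enum i    ≈⟨ +-congˡ (trans (reflexive (cong enum (≡.sym negate-i≡i))) (enum-negate i)) ⟩
      enum i + - enum i  ≈⟨ -‿inverseʳ (enum i) ⟩
      0#                 ≈⟨ zeroʳ two ⟨
      two * 0#           ∎)))
    open OrbitCounting Fin._≟_ negate 2 negate-involutive negate^i-moves
    counting = length≡1+m*k negate-o fixed⇒o (allFin⁺ q) ∈-allFin
    m = proj₁ counting
    q≡1+m*2 : q ≡ 1 ℕ.+ m ℕ.* 2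
    q≡1+m*2 = ≡.trans (≡.sym (length-tabulate (λ i → i))) (proj₂ counting)

  3∣q⇒three≈0 : 3 ∣ q → three ≈ 0#
  3∣q⇒three≈0 3∣q with three ≟ 0#
  ... | yes three≈0 = three≈0
  ... | no  three≉0 = ⊥-elim (3≢1 (∣1+m*n⇒≡1 m (≡.subst (3 ∣_) q*q≡1+m*3 (∣m⇒∣m*n q 3∣q))))
    where
    3≢1 : 3 ≢ 1
    3≢1 ()
    fixed⇒o : ∀ {p} → rotate p ≡ p → p ≡ (o , o)
    fixed⇒o {a , b} rotate-p≡p = cong₂ _,_ a≡o (≡.trans b≡a a≡o)
      where
      b≡a : b ≡ a
      b≡a = cong proj₁ rotate-p≡p
      third-a-b≡a : third a b ≡ a
      third-a-b≡a = ≡.trans (cong proj₂ rotate-p≡p) b≡a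
      a≡o : a ≡ o
      a≡o = ≡.sym (index-unique (*-cancelˡ three≉0 (begin
        three * enum a                      ≈⟨ solve 1 (λ x → (con 1 :+ con 1 :+ con 1) :* x := x :+ x :+ x)
                                                     refl (enum a) ⟩
        enum a + enum a + enum a            ≈⟨ +-cong (+-congˡ (reflexive (cong enum (≡.sym b≡a))))
                                                      (reflexive (cong enum (≡.sym third-a-b≡a))) ⟩
        enum a + enum b + enum (third a b)  ≈⟨ sum-third a b ⟩
        0#                                  ≈⟨ zeroʳ three ⟨
        three * 0#                          ∎)))
    open OrbitCounting (≡-dec Fin._≟_ Fin._≟_) rotate 3 rotate³≡id rotate^i-moves
    counting = length≡1+m*k rotate-o fixed⇒o pairs-unique ∈-pairs
    m = proj₁ counting
    q*q≡1+m*3 : q ℕ.* q ≡ 1 ℕ.+ m ℕ.* 3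
    q*q≡1+m*3 = ≡.trans (≡.sym length-pairs) (proj₂ counting)

  2∣q⇒nine*x≈x : 2 ∣ q → ∀ x → nine * x ≈ x
  2∣q⇒nine*x≈x 2∣q x = begin
    three * three * x  ≈⟨ *-congʳ (*-cong three≈1 three≈1) ⟩
    1# * 1# * x        ≈⟨ solve 1 (λ x → con 1 :* con 1 :* x := x) refl x ⟩
    x                  ∎
    where
    three≈1 : three ≈ 1#
    three≈1 = trans (+-congʳ (2∣q⇒two≈0 2∣q)) (+-identityˡ 1#)

  3∣q⇒nine*x≈0 : 3 ∣ q → ∀ x → nine * x ≈ 0#
  3∣q⇒nine*x≈0 3∣q x = begin
    three * three * x  ≈⟨ *-congʳ (*-cong three≈0 three≈0) ⟩
    0# * 0# * x        ≈⟨ solve 1 (λ x → con 0 :* con 0 :* x := con 0) refl x ⟩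
    0#                 ∎
    where
    three≈0 = 3∣q⇒three≈0 3∣q

module LineGeometry (R : CommutativeRing 0ℓ 0ℓ) where
  open CommutativeRing R
  open Geometry R
  open LineMu R
  open AbelianGroupProperties +-abelianGroup using (x∙y⁻¹≈ε⇒x≈y; ⁻¹-∙-comm)
  open NaturalCoefficients commutativeSemiring using (solve; _:=_; _:+_; _:*_; con)
  open import Relation.Binary.Reasoning.Setoid setoid

  InOsc-cong : ∀ {t X Y} → (∀ i → X i ≈ Y i) → InOsc t X → InOsc t Y
  InOsc-cong X≈Y = trans (sym
    (+-cong (+-cong (+-cong (X≈Y 0F) (-‿cong (*-congˡ (X≈Y 1F)))) (*-congˡ (X≈Y 2F)))
            (-‿cong (*-congˡ (X≈Y 3F)))))

  OnLine-cong : ∀ {A A′ B B′ X} → (∀ i → A i ≈ A′ i) → (∀ i → B i ≈ B′ i) →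
                OnLine A B X → OnLine A′ B′ X
  OnLine-cong A≈A′ B≈B′ (a , b , X≈aA+bB) =
    a , b , λ i → trans (X≈aA+bB i) (+-cong (*-congˡ (A≈A′ i)) (*-congˡ (B≈B′ i)))

  InOsc-balanced : ∀ {t X} → InOsc t X →
                   x₀ X + three * (t * t) * x₂ X ≈ three * t * x₁ X + t * t * t * x₃ X
  InOsc-balanced {t} {X} osc = x∙y⁻¹≈ε⇒x≈y _ _ (begin
      (a + c) - (b + d)        ≈⟨ +-congˡ (⁻¹-∙-comm b d) ⟨
      (a + c) + (- b + - d)    ≈⟨ solve 4 (λ a c nb nd → (a :+ c) :+ (nb :+ nd) := ((a :+ nb) :+ c) :+ nd)
                                        refl a c (- b) (- d) ⟩
      a - b + c - d            ≈⟨ osc ⟩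
      0#                       ∎)
    where
    a = x₀ X
    b = three * t * x₁ X
    c = three * (t * t) * x₂ X
    d = t * t * t * x₃ X

  InOsc-Aμ : ∀ {t a} → InOsc t (Aμ a) → three * t * a + t * t * t ≈ 0#
  InOsc-Aμ {t} {a} osc = begin
    three * t * a + t * t * t       ≈⟨ +-congˡ (*-identityʳ (t * t * t)) ⟨
    three * t * a + t * t * t * 1#  ≈⟨ InOsc-balanced {X = Aμ a} osc ⟨
    0# + three * (t * t) * 0#       ≈⟨ trans (+-identityˡ _) (zeroʳ _) ⟩
    0#                              ∎

  InOsc-B₀ : ∀ {t} → InOsc t B₀ → 1# + three * (t * t) ≈ 0#
  InOsc-B₀ {t} osc = begin
    1# + three * (t * t)            ≈⟨ +-congˡ (*-identityʳ (three * (t * t))) ⟨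
    1# + three * (t * t) * 1#       ≈⟨ InOsc-balanced {X = B₀} osc ⟩
    three * t * 0# + t * t * t * 0# ≈⟨ trans (+-cong (zeroʳ _) (zeroʳ _)) (+-identityʳ 0#) ⟩
    0#                              ∎

  -- 9a − 1 lies in the ideal of the two plane equations u = 3ta + t³ and v = 1 + 3t²:
  -- 9a + 9t·u + v = 1 + 3(3a + t²)·v.
  InOsc-Aμ-B₀⇒nine*a≈1 : ∀ {t a} → InOsc t (Aμ a) → InOsc t B₀ → nine * a ≈ 1#
  InOsc-Aμ-B₀⇒nine*a≈1 {t} {a} osc-A osc-B = begin
    nine * a                        ≈⟨ solve 3 (λ h t a → h :* h :* a := h :* h :* a :+ h :* h :* t :* con 0 :+ con 0)
                                             refl h t a ⟩
    nine * a + h * h * t * 0# + 0#  ≈⟨ +-cong (+-congˡ (*-congˡ (InOsc-Aμ osc-A))) (InOsc-B₀ osc-B) ⟨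
    nine * a + h * h * t * u + v    ≈⟨ solve 3 (λ h t a → h :* h :* a :+ h :* h :* t :* (h :* t :* a :+ t :* t :* t)
                                                            :+ (con 1 :+ h :* (t :* t))
                                                       := con 1 :+ h :* (h :* a :+ t :* t) :* (con 1 :+ h :* (t :* t)))
                                             refl h t a ⟩
    1# + h * (h * a + t * t) * v    ≈⟨ +-congˡ (*-congˡ (InOsc-B₀ osc-B)) ⟩
    1# + h * (h * a + t * t) * 0#   ≈⟨ trans (+-congˡ (zeroʳ _)) (+-identityʳ 1#) ⟩
    1#                              ∎
    where
    h = three
    u = three * t * a + t * t * t
    v = 1# + three * (t * t)

  OnLine-P⇒ : ∀ {t a} → OnLine (Aμ a) B₀ (P t) → t * t * t ≈ t × t * t ≈ a
  OnLine-P⇒ {t} {a} (α , β , P≈αA+βB) = t³≈t , t²≈a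
    where
    β≈t : β ≈ t
    β≈t = sym (trans (P≈αA+βB 2F) (solve 2 (λ α β → α :* con 0 :+ β :* con 1 := β) refl α β))
    t³≈t : t * t * t ≈ t
    t³≈t = trans (P≈αA+βB 0F) (trans (solve 2 (λ α β → α :* con 0 :+ β :* con 1 := β) refl α β) β≈t)
    α≈1 : α ≈ 1#
    α≈1 = sym (trans (P≈αA+βB 3F) (solve 2 (λ α β → α :* con 1 :+ β :* con 0 := α) refl α β))
    t²≈a : t * t ≈ a
    t²≈a = trans (P≈αA+βB 1F) (trans (solve 3 (λ α β a → α :* a :+ β :* con 0 := α :* a) refl α β a)
                                     (trans (*-congʳ α≈1) (*-identityˡ a)))

  OnLine-P∞⇒1≈0 : ∀ {a} → OnLine (Aμ a) B₀ P∞ → 1# ≈ 0#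
  OnLine-P∞⇒1≈0 (α , β , P∞≈αA+βB) = trans (P∞≈αA+βB 0F) (sym (P∞≈αA+βB 2F))

module Embedding {F K : CommutativeRing 0ℓ 0ℓ} {q n : ℕ}
                 (isFiniteFieldF : IsFiniteField F q) (isFiniteFieldK : IsFiniteField K n)
                 {ι : CommutativeRing.Carrier F → CommutativeRing.Carrier K} (ι-hom : IsRingHom F K ι) where
  private
    module F = CommutativeRing F
    module K = CommutativeRing K
    module GF = Geometry F
    module GK = Geometry K
    module FK = FiniteField isFiniteFieldK
    module LK = LineGeometry K
  open RingMorphisms F.rawRing K.rawRing using (module IsRingHomomorphism)
  open IsRingHomomorphism ι-hom
  open import Relation.Binary.Reasoning.Setoid K.setoid

  ι-injective : ∀ {x y} → ι x K.≈ ι y → x F.≈ y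
  ι-injective {x} {y} ιx≈ιy with IsFiniteField._≟_ isFiniteFieldF (x F.- y) F.0#
  ... | yes x-y≈0 = x∙y⁻¹≈ε⇒x≈y x y x-y≈0
    where open AbelianGroupProperties F.+-abelianGroup using (x∙y⁻¹≈ε⇒x≈y)
  ... | no  x-y≉0 with IsFiniteField.inverse isFiniteFieldF _ x-y≉0
  ... | w , [x-y]w≈1 = ⊥-elim (IsFiniteField.1≉0 isFiniteFieldK (begin
    K.1#                        ≈⟨ 1#-homo ⟨
    ι F.1#                      ≈⟨ ⟦⟧-cong [x-y]w≈1 ⟨
    ι ((x F.- y) F.* w)         ≈⟨ *-homo _ w ⟩
    ι (x F.- y) K.* ι w         ≈⟨ K.*-congʳ (+-homo x (F.- y)) ⟩
    (ι x K.+ ι (F.- y)) K.* ι w ≈⟨ K.*-congʳ (K.+-cong ιx≈ιy (-‿homo y)) ⟩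
    (ι y K.- ι y) K.* ι w       ≈⟨ K.*-congʳ (K.-‿inverseʳ (ι y)) ⟩
    K.0# K.* ι w                ≈⟨ K.zeroˡ (ι w) ⟩
    K.0#                        ∎))

  ι-nine : ι GF.nine K.≈ GK.nine
  ι-nine = K.trans (*-homo GF.three GF.three) (K.*-cong ι-three ι-three)
    where
    ι-three : ι GF.three K.≈ GK.three
    ι-three = K.trans (+-homo _ _) (K.+-cong (K.trans (+-homo _ _) (K.+-cong 1#-homo 1#-homo)) 1#-homo)

  ι-Aμ : ∀ x i → ι (LineMu.Aμ F x i) K.≈ LineMu.Aμ K (ι x) i
  ι-Aμ x 0F = 0#-homo
  ι-Aμ x 1F = K.refl
  ι-Aμ x 2F = 0#-homo
  ι-Aμ x 3F = 1#-homo

  ι-B₀ : ∀ i → ι (LineMu.B₀ F i) K.≈ LineMu.B₀ K i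
  ι-B₀ 0F = 1#-homo
  ι-B₀ 1F = 0#-homo
  ι-B₀ 2F = 1#-homo
  ι-B₀ 3F = 0#-homo

  x*x*x≈x⇒∈image : ∀ {t} → t K.* t K.* t K.≈ t → ∃ λ c → ι c K.≈ t
  x*x*x≈x⇒∈image t³≈t with FK.x*x*x≈x⇒x≈0⊎x*x≈1 t³≈t
  ... | inj₁ t≈0 = F.0# , K.trans 0#-homo (K.sym t≈0)
  ... | inj₂ t²≈1 with FK.x*x≈1⇒x≈1⊎x≈-1 t²≈1
  ... | inj₁ t≈1  = F.1# , K.trans 1#-homo (K.sym t≈1)
  ... | inj₂ t≈-1 = F.- F.1# , K.trans (-‿homo F.1#) (K.trans (K.-‿cong 1#-homo) (K.sym t≈-1))

  OnLine-ι-P⇒∈image : ∀ {x t} → GK.OnLine (λ i → ι (LineMu.Aμ F x i)) (λ i → ι (LineMu.B₀ F i)) (GK.P t) →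
                      ∃ λ c → ι c K.≈ t
  OnLine-ι-P⇒∈image {x} on-ℓ =
    x*x*x≈x⇒∈image (proj₁ (LK.OnLine-P⇒ (LK.OnLine-cong (ι-Aμ x) ι-B₀ on-ℓ)))

  InOsc-ι⇒nine*x≈1 : ∀ {x t} → GK.InOsc t (λ i → ι (LineMu.Aμ F x i)) →
                     GK.InOsc t (λ i → ι (LineMu.B₀ F i)) → GF.nine F.* x F.≈ F.1#
  InOsc-ι⇒nine*x≈1 {x} A∈π B∈π = ι-injective (begin
    ι (GF.nine F.* x)  ≈⟨ *-homo GF.nine x ⟩
    ι GF.nine K.* ι x  ≈⟨ K.*-congʳ ι-nine ⟩
    GK.nine K.* ι x    ≈⟨ LK.InOsc-Aμ-B₀⇒nine*a≈1 (LK.InOsc-cong (ι-Aμ x) A∈π)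
                                                 (LK.InOsc-cong ι-B₀ B∈π) ⟩
    K.1#               ≈⟨ 1#-homo ⟨
    ι F.1#             ∎)

open import Data.Nat using (_≤_; _*_; _%_)

lemma4p4 : (q : ℕ) → 5 ≤ q →
  (F : CommutativeRing 0ℓ 0ℓ) → IsFiniteField F q →
  (K : CommutativeRing 0ℓ 0ℓ) → IsFiniteField K (q * q) →
  (ι : CommutativeRing.Carrier F → CommutativeRing.Carrier K) → IsRingHom F K ι →
  (μ : CommutativeRing.Carrier F) →
  ¬ CommutativeRing._≈_ F μ (CommutativeRing.0# F) →
  ¬ CommutativeRing._≈_ F μ (CommutativeRing.1# F) →
  (q % 2 ≡ 0
    ⊎ q % 3 ≡ 0
    ⊎ (q % 3 ≢ 0 × q % 2 ≡ 1 ×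
       ¬ CommutativeRing._≈_ F (CommutativeRing._*_ F (Geometry.nine F) μ) (CommutativeRing.1# F))) →
  EnΓ.IsEnΓLine q F K ι (LineMu.Aμ F μ) (LineMu.B₀ F)
lemma4p4 q _ F isFiniteFieldF K isFiniteFieldK ι ι-hom μ μ≉0 μ≉1 char = record
  { noCubicPoint  = λ t on-ℓ → noCubicPoint (LF.OnLine-P⇒ on-ℓ)
  ; noCubicPoint∞ = λ on-ℓ → 1≉0 (LF.OnLine-P∞⇒1≈0 on-ℓ)
  ; notInOsc      = λ t (A∈π , B∈π) → nine*μ≉1 (LF.InOsc-Aμ-B₀⇒nine*a≈1 A∈π B∈π)
  ; notInOsc∞     = λ (A∈π∞ , _) → 1≉0 A∈π∞
  ; notImagChord  = λ (t , t∉F , on-ℓ , _) → t∉F (ι-F.OnLine-ι-P⇒∈image on-ℓ)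
  ; notImagAxis   = λ (t , _ , (A∈π , B∈π) , _) → nine*μ≉1 (ι-F.InOsc-ι⇒nine*x≈1 A∈π B∈π)
  }
  where
  module F = CommutativeRing F
  module LF = LineGeometry F
  module FF = FiniteField isFiniteFieldF
  module ι-F = Embedding isFiniteFieldF isFiniteFieldK ι-hom
  open IsFiniteField isFiniteFieldF using (1≉0)

  noCubicPoint : ∀ {t} → t F.* t F.* t F.≈ t × t F.* t F.≈ μ → ⊥
  noCubicPoint (t³≈t , t²≈μ) with FF.x*x*x≈x⇒x≈0⊎x*x≈1 t³≈t
  ... | inj₁ t≈0  = μ≉0 (F.trans (F.sym t²≈μ) (F.trans (F.*-congˡ t≈0) (F.zeroʳ _)))
  ... | inj₂ t²≈1 = μ≉1 (F.trans (F.sym t²≈μ) t²≈1)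

  nine*μ≉1 : ¬ Geometry.nine F F.* μ F.≈ F.1#
  nine*μ≉1 = [ (λ q%2≡0 9μ≈1 → μ≉1 (F.trans (F.sym (FF.2∣q⇒nine*x≈x (m%n≡0⇒n∣m q 2 q%2≡0) μ)) 9μ≈1))
             , [ (λ q%3≡0 9μ≈1 → 1≉0 (F.trans (F.sym 9μ≈1) (FF.3∣q⇒nine*x≈0 (m%n≡0⇒n∣m q 3 q%3≡0) μ)))
               , (λ (_ , _ , 9μ≉1) → 9μ≉1)
               ]′
             ]′ char
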